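{- The transitive closure function $\mathrm{TC}(x/-)=x\cup\bigcup\{\mathrm{TC}(y/-):y\in x\}$ and the rank function $\mathrm{rank}(x/-)=\bigcup\{\mathrm{rank}(y/-)+1: y\in x\}$ (each with one normal argument and no safe arguments) are in ${\sf PCSF}$.
   Context: For a set $a$, $a+1=a\cup\{a\}$. Functions are set-theoretic functions on the universe of sets, written $f(x_1,\ldots,x_n/a_1,\ldots,a_m)$: arguments before the slash are called normal, after it safe (either list may be empty, written $-$). The class ${\sf PCSF}^-$ consists of functions with no normal arguments; it contains the projections $\pi^{ -,m}_j(-/a_1,\ldots,a_m)=a_j$, $\mathrm{pair}(-/a,b)=\{a,b\}$, $\mathrm{null}(-/-)=\emptyset$, $\mathrm{union}(-/a)=\bigcup a$, and $\mathrm{Cond}_\in(-/a,b,c,d)$, which equals $a$ if $c\in d$ and $b$ otherwise; and it is closed under composition $f(-/\vec a)=h(-/t_1(-/\vec a),\ldots,t_k(-/\vec a))$ and under safe separation: if $h(-/\vec a,b)\in{\sf PCSF}^-$ then $f(-/\vec a,c)=\{b\in c: h(-/\vec a,b)\neq\emptyset\}\in{\sf PCSF}^-$. The class ${\sf PCSF}$ is the smallest class containing ${\sf PCSF}^-$ and all projections $\pi^{n,m}_j(x_1,\ldots,x_n/x_{n+1},\ldots,x_{n+m})=x_j$, and closed under safe composition $f(\vec x/\vec a)=h(r_1(\vec x/-),\ldots,r_k(\vec x/-)/t_1(\vec x/\vec a),\ldots,t_l(\vec x/\vec a))$ (with $h,r_i,t_j\in{\sf PCSF}$, the $r_i$ having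 no safe arguments) and predicative set recursion $f(x,\vec y/\vec a)=h(x,\vec y/\vec a,\{f(z,\vec y/\vec a): z\in x\})$ (with $h\in{\sf PCSF}$). -}

module Defs where

open import Data.Nat using (ℕ; zero; suc; _+_)
open import Data.Fin using (Fin)
open import Data.Vec using (Vec; []; _∷_; _∷ʳ_; lookup; tabulate; init; last; _++_)
open import Data.Bool using (Bool; true; false; if_then_else_)
open import Data.Empty using (⊥)
open import Data.Product using (Σ; ∃; _×_; _,_; proj₁; proj₂)
open import Relation.Nullary using (¬_; Dec)
open import Relation.Nullary.Decidable using (⌊_⌋)

-- The universe of sets: Aczel's iterative sets (well-founded trees),
-- with extensional equality _≈_ and membership _∈_.

data V : Set₁ where
  sup : (A : Set) → (A → V) → V

Idx : V → Set
Idx (sup A f) = A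

El : (x : V) → Idx x → V
El (sup A f) = f

_≈_ : V → V → Set
sup A f ≈ sup B g =
  ((a : A) → Σ B λ b → f a ≈ g b) × ((b : B) → Σ A λ a → f a ≈ g b)

infix 4 _≈_ _∈_

_∈_ : V → V → Set
x ∈ y = Σ (Idx y) λ i → x ≈ El y i

∅ : V
∅ = sup ⊥ (λ ())

pairV : V → V → V
pairV a b = sup Bool (λ t → if t then a else b)

⋃ : V → V
⋃ x = sup (Σ (Idx x) λ i → Idx (El x i)) (λ p → El (El x (proj₁ p)) (proj₂ p))

_∪_ : V → V → V
a ∪ b = ⋃ (pairV a b)

succV : V → V
succV a = a ∪ pairV a a

-- Transitive closure and rank, defined by ∈-recursion as in the paper.
-- { TC(y) : y ∈ x } is the set indexed by the same index type as x.

TC : V → V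
TC (sup A f) = sup A f ∪ ⋃ (sup A (λ a → TC (f a)))

rank : V → V
rank (sup A f) = ⋃ (sup A (λ a → succV (rank (f a))))

-- Excluded middle (the ambient set theory is classical; needed to
-- define Cond_∈ literally as "a if c ∈ d, b otherwise").

LEM : Set₁
LEM = (P : Set) → Dec P

-- Syntax of PCSF⁻ : F⁻ m = functions with no normal and m safe arguments.

data F⁻ : ℕ → Set where
  projF⁻ : ∀ {m} → Fin m → F⁻ m
  pairF⁻ : F⁻ 2
  nullF⁻ : F⁻ 0
  unionF⁻ : F⁻ 1
  condF⁻ : F⁻ 4
  compF⁻ : ∀ {k m} → F⁻ k → (Fin k → F⁻ m) → F⁻ m
  -- from h(-/a⃗,b) get f(-/a⃗,c) = {b ∈ c : h(-/a⃗,b) ≠ ∅}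
  sepF⁻ : ∀ {m} → F⁻ (suc m) → F⁻ (suc m)

-- Syntax of PCSF : PCSF n m = functions with n normal, m safe arguments.
data PCSF : ℕ → ℕ → Set where
  base : ∀ {m} → F⁻ m → PCSF 0 m
  proj : ∀ {n m} → Fin (n + m) → PCSF n m
  -- f(x⃗/a⃗) = h(r₁(x⃗/-),…,r_k(x⃗/-) / t₁(x⃗/a⃗),…,t_l(x⃗/a⃗))
  scomp : ∀ {k l n m} → PCSF k l → (Fin k → PCSF n 0) → (Fin l → PCSF n m) → PCSF n m
  -- f(x,y⃗/a⃗) = h(x,y⃗/a⃗,{f(z,y⃗/a⃗) : z ∈ x})
  rec : ∀ {n m} → PCSF (suc n) (suc m) → PCSF (suc n) m

module Semantics (lem : LEM) where

  Cond∈ : V → V → V → V → V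
  Cond∈ a b c d = if ⌊ lem (c ∈ d) ⌋ then a else b

  ⟦_⟧⁻ : ∀ {m} → F⁻ m → Vec V m → V
  ⟦ projF⁻ j ⟧⁻ as = lookup as j
  ⟦ pairF⁻ ⟧⁻ (a ∷ b ∷ []) = pairV a b
  ⟦ nullF⁻ ⟧⁻ [] = ∅
  ⟦ unionF⁻ ⟧⁻ (a ∷ []) = ⋃ a
  ⟦ condF⁻ ⟧⁻ (a ∷ b ∷ c ∷ d ∷ []) = Cond∈ a b c d
  ⟦ compF⁻ h ts ⟧⁻ as = ⟦ h ⟧⁻ (tabulate λ i → ⟦ ts i ⟧⁻ as)
  ⟦ sepF⁻ h ⟧⁻ as =
    sup (Σ (Idx (last as)) λ i → ¬ (⟦ h ⟧⁻ (init as ∷ʳ El (last as) i) ≈ ∅))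
        (λ p → El (last as) (proj₁ p))

  recV : ∀ {n m} → (Vec V (suc n) → Vec V (suc m) → V) → V → Vec V n → Vec V m → V
  recV h (sup A f) ys as = h (sup A f ∷ ys) (as ∷ʳ sup A (λ i → recV h (f i) ys as))

  ⟦_⟧ : ∀ {n m} → PCSF n m → Vec V n → Vec V m → V
  ⟦ base f ⟧ [] as = ⟦ f ⟧⁻ as
  ⟦ proj j ⟧ xs as = lookup (xs ++ as) j
  ⟦ scomp h rs ts ⟧ xs as =
    ⟦ h ⟧ (tabulate λ i → ⟦ rs i ⟧ xs []) (tabulate λ i → ⟦ ts i ⟧ xs as)
  ⟦ rec h ⟧ (x ∷ ys) as = recV ⟦ h ⟧ x ys as

InPCSF₁₀ : LEM → (V → V) → Set₁
InPCSF₁₀ lem g = Σ (PCSF 1 0) λ t → (x : V) → Semantics.⟦_⟧ lem t (x ∷ []) [] ≈ g x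

module Submission where

-- Both TC and rank are defined by ∈-recursion,
--   g(x) = H(x, {g(y) : y ∈ x}),
-- and predicative set recursion is exactly the PCSF scheme for such
-- definitions.  We prove one general principle (recursion-in-PCSF): if
-- the step H is denoted by a PCSF term with one normal and one safe
-- argument and H respects set equality in its second argument, then g
-- is in PCSF; the proof is ∈-induction on x.  It then remains to give
-- the two steps as PCSF⁻ terms of two safe arguments x, R:
--   TC   : H(x, R) = x ∪ ⋃R   (literally the defining equation),
--   rank : H(x, R) = ⋃R ∪ R,  since ⋃{s + 1 : s ∈ R} = ⋃R ∪ R
--          (lemma ⋃-succ-family).

open import Defs
open import Data.Product using (_×_; Σ; _,_)
open import Data.Nat using (ℕ)
open import Data.Fin using (zero; suc)
open import Data.Vec using ([]; _∷_)
open import Data.Bool using (true; false)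

≈-refl : (x : V) → x ≈ x
≈-refl (sup A f) = (λ a → a , ≈-refl (f a)) , (λ a → a , ≈-refl (f a))

≈-trans : {x y z : V} → x ≈ y → y ≈ z → x ≈ z
≈-trans {sup A f} {sup B g} {sup C h} (p , q) (r , s) =
  (λ a → let (b , fa≈gb) = p a ; (c , gb≈hc) = r b in
     c , ≈-trans fa≈gb gb≈hc) ,
  (λ c → let (b , gb≈hc) = s c ; (a , fa≈gb) = q b in
     a , ≈-trans fa≈gb gb≈hc)

≈-forth : {x y : V} → x ≈ y → (i : Idx x) → Σ (Idx y) λ j → El x i ≈ El y j
≈-forth {sup A f} {sup B g} (p , _) = p

≈-back : {x y : V} → x ≈ y → (j : Idx y) → Σ (Idx x) λ i → El x i ≈ El y j
≈-back {sup A f} {sup B g} (_ , q) = q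

family-cong : (A : Set) {f g : A → V} → ((a : A) → f a ≈ g a) → sup A f ≈ sup A g
family-cong A f≈g = (λ a → a , f≈g a) , (λ a → a , f≈g a)

pair-cong : {a a′ b b′ : V} → a ≈ a′ → b ≈ b′ → pairV a b ≈ pairV a′ b′
pair-cong a≈a′ b≈b′ =
  (λ { true → true , a≈a′ ; false → false , b≈b′ }) ,
  (λ { true → true , a≈a′ ; false → false , b≈b′ })

⋃-cong : {x y : V} → x ≈ y → ⋃ x ≈ ⋃ y
⋃-cong {sup A f} {sup B g} (p , q) =
  (λ { (a , i) → let (b , fa≈gb) = p a ; (j , e) = ≈-forth fa≈gb i in (b , j) , e }) ,
  (λ { (b , j) → let (a , fa≈gb) = q b ; (i , e) = ≈-back fa≈gb j in (a , i) , e })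

∪-cong : {a a′ b b′ : V} → a ≈ a′ → b ≈ b′ → a ∪ b ≈ a′ ∪ b′
∪-cong a≈a′ b≈b′ = ⋃-cong (pair-cong a≈a′ b≈b′)

⋃-succ-family : (A : Set) (s : A → V) →
  ⋃ (sup A s) ∪ sup A s ≈ ⋃ (sup A (λ a → succV (s a)))
⋃-succ-family A s =
  (λ { (true , a , i) → (a , true , i) , ≈-refl (El (s a) i)
     ; (false , a)    → (a , false , true) , ≈-refl (s a) }) ,
  (λ { (a , true , i)      → (true , a , i) , ≈-refl (El (s a) i)
     ; (a , false , true)  → (false , a) , ≈-refl (s a)
     ; (a , false , false) → (false , a) , ≈-refl (s a) })

-- PCSF⁻ vocabulary: terms for ⋃, pairing and binary union, and the
-- embedding of a two-safe-argument PCSF⁻ function f(-/x, R) as the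
-- PCSF function f(x/R) (a normal argument may always be used safely).

union⁻ : {m : ℕ} → F⁻ m → F⁻ m
union⁻ t = compF⁻ unionF⁻ (λ _ → t)

pair⁻ : {m : ℕ} → F⁻ m → F⁻ m → F⁻ m
pair⁻ s t = compF⁻ pairF⁻ (λ { zero → s ; (suc _) → t })

_∪⁻_ : {m : ℕ} → F⁻ m → F⁻ m → F⁻ m
s ∪⁻ t = union⁻ (pair⁻ s t)

-- The two safe arguments x and R of a step function.
arg₀ arg₁ : F⁻ 2
arg₀ = projF⁻ zero
arg₁ = projF⁻ (suc zero)

normalAsSafe : F⁻ 2 → PCSF 1 1
normalAsSafe f = scomp (base f) (λ ()) (λ { zero → proj zero ; (suc _) → proj (suc zero) })

tcStep rankStep : PCSF 1 1
tcStep   = normalAsSafe (arg₀ ∪⁻ union⁻ arg₁)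
rankStep = normalAsSafe (union⁻ arg₁ ∪⁻ arg₁)

image : V → (V → V) → V
image x g = sup (Idx x) (λ i → g (El x i))

module _ (lem : LEM) where
  open Semantics lem

  recursion-in-PCSF :
    (h : PCSF 1 1) (H : V → V → V) (g : V → V) →
    (∀ x R → ⟦ h ⟧ (x ∷ []) (R ∷ []) ≈ H x R) →
    (∀ x {R R′} → R ≈ R′ → H x R ≈ H x R′) →
    (∀ x → H x (image x g) ≈ g x) →
    InPCSF₁₀ lem g
  recursion-in-PCSF h H g h-denotes-H H-cong g-recursion = rec h , rec-correct
    where
      rec-correct : (x : V) → ⟦ rec h ⟧ (x ∷ []) [] ≈ g x
      rec-correct (sup A f) =
        ≈-trans (h-denotes-H x _)
          (≈-trans (H-cong x (family-cong A (λ a → rec-correct (f a))))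
                   (g-recursion x))
        where
          x : V
          x = sup A f

  TC-in-PCSF : InPCSF₁₀ lem TC
  TC-in-PCSF =
    recursion-in-PCSF tcStep (λ x R → x ∪ ⋃ R) TC
      (λ x R → ≈-refl (x ∪ ⋃ R))
      (λ x R≈R′ → ∪-cong (≈-refl x) (⋃-cong R≈R′))
      (λ { (sup A f) → ≈-refl (TC (sup A f)) })

  -- rank(x) = ⋃{rank(y) + 1 : y ∈ x} = ⋃R ∪ R with R = {rank(y) : y ∈ x}.
  rank-in-PCSF : InPCSF₁₀ lem rank
  rank-in-PCSF =
    recursion-in-PCSF rankStep (λ _ R → ⋃ R ∪ R) rank
      (λ _ R → ≈-refl (⋃ R ∪ R))
      (λ _ R≈R′ → ∪-cong (⋃-cong R≈R′) R≈R′)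
      (λ { (sup A f) → ⋃-succ-family A (λ a → rank (f a)) })

proposition3p2p11 : (lem : LEM) → InPCSF₁₀ lem TC × InPCSF₁₀ lem rank
proposition3p2p11 lem = TC-in-PCSF lem , rank-in-PCSF lem
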